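{- Let $n\in\mathbb{N}$ be even with $n\geq 8$, and let $G=C_n(\{1,3,n-3,n-1\})$. Then $\lambda_{(3,2,1)}(G)=15$ if $n\in\{8,16\}$, and $\lambda_{(3,2,1)}(G)\leq 13$ otherwise.
   Context: For $n\ge 3$ and $S\subseteq\{1,\dots,n-1\}$ closed under $x\mapsto n-x$, the circulant $C_n(S)$ is the graph with vertex set $\{u_1,\dots,u_n\}$ in which $u_iu_j$ is an edge iff $|i-j|\in S$. An $L(3,2,1)$-labeling of a graph $G$ is a function $f:V(G)\to\mathbb{N}\cup\{0\}$ such that $|f(x)-f(y)|>3-\operatorname{dist}_G(x,y)$ for all distinct $x,y\in V(G)$. $\lambda_{(3,2,1)}(G)$ is the minimum, over all $L(3,2,1)$-labelings of $G$, of the difference between the largest and smallest label used. -}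

module Defs where

open import Data.Nat using (ℕ; zero; suc; _+_; _∸_; _<_; _≤_; ∣_-_∣)
open import Data.Fin using (Fin; toℕ)
open import Data.Product using (Σ; _×_; _,_; ∃)
open import Data.Sum using (_⊎_)
open import Relation.Binary.PropositionalEquality using (_≡_; _≢_)
open import Relation.Nullary using (¬_)

Graph : ℕ → Set₁
Graph n = Fin n → Fin n → Set

-- Circulant C_n(S): vertex u_i is represented by index i (0-based shift
-- is irrelevant since only differences matter); u_i u_j is an edge iff |i-j| ∈ S.
Circulant : (n : ℕ) → (S : ℕ → Set) → Graph n
Circulant n S i j = S ∣ toℕ i - toℕ j ∣

S13 : ℕ → ℕ → Set
S13 n d = d ≡ 1 ⊎ d ≡ 3 ⊎ d ≡ n ∸ 3 ⊎ d ≡ n ∸ 1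

data Walk {n : ℕ} (G : Graph n) : Fin n → Fin n → ℕ → Set where
  nil  : ∀ {x} → Walk G x x 0
  cons : ∀ {x y z k} → G x y → Walk G y z k → Walk G x z (suc k)

Dist : {n : ℕ} → Graph n → Fin n → Fin n → ℕ → Set
Dist G x y d = Walk G x y d × (∀ k → k < d → ¬ Walk G x y k)

-- L(3,2,1)-labeling: |f x - f y| > 3 - dist(x,y) for distinct x, y
-- (written as 3 < |f x - f y| + dist(x,y) to avoid truncated subtraction).
IsL321 : {n : ℕ} → Graph n → (Fin n → ℕ) → Set
IsL321 G f = ∀ x y → x ≢ y → ∀ d → Dist G x y d → 3 < ∣ f x - f y ∣ + d

SpanAtMost : {n : ℕ} → (Fin n → ℕ) → ℕ → Set
SpanAtMost f k = ∀ x y → f x ∸ f y ≤ k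

λ321≤ : {n : ℕ} → Graph n → ℕ → Set
λ321≤ G k = Σ _ λ f → IsL321 G f × SpanAtMost f k

λ321≡ : {n : ℕ} → Graph n → ℕ → Set
λ321≡ G k = λ321≤ G k × (∀ j → j < k → ¬ λ321≤ G j)

-- Call a labelling w of the positions 0, …, n-1 cyclically separated when labels at cyclic
-- gap t < 10 differ by at least sep t.  An edge of C_n({1,3,n-3,n-1}) moves a position by
-- ±1 or ±3 modulo n, and k ≤ 3 such moves either return to the start or move it by some t
-- with sep t + k > 3; hence cyclically separated labellings are L(3,2,1)-labellings.
-- Separation only looks at ten consecutive labels, so cyclic words that begin with the
-- same nine letters can be glued together: words of lengths 10, 14, 22 and 26 with labels
-- ≤ 13 and a common prefix yield every even n ≥ 20, and single words cover n = 10, 12, 14,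
-- 18.  For n = 8 and 16 explicit words have span 15.  Conversely, an L(3,2,1)-labelling of
-- span ≤ 14, rotated so that a least label sits at position 0 and shifted so that this
-- label is 0, satisfies constraints coming from explicit short walks, and an exhaustive
-- search shows that no labels 0, …, 14 satisfy them.
module Submission where

open import Defs
open import Data.Nat using (ℕ; zero; suc; _+_; _*_; _∸_; _⊔_; _<_; _≤_; _%_; _/_; ∣_-_∣; NonZero; z≤n; s≤s; _<?_; _≤?_; _≟_)
open import Data.Nat.Properties
open import Data.Nat.DivMod using (_mod_; %-distribˡ-+; [m+kn]%n≡m%n; [m+n]%n≡m%n; m<n⇒m%n≡m; m≡m%n+[m/n]*n; m%n≤n)
open import Data.Nat.Induction using (<-rec)
open import Data.Fin using (Fin; toℕ; zero)
open import Data.Fin.Properties using (toℕ-injective; toℕ<n; toℕ-fromℕ<; any?; all?) renaming (_≟_ to _≟ᶠ_)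
open import Data.Vec using (Vec; []; _∷_; map; sum)
open import Data.List using (List; []; _∷_; _++_; take; length; downFrom; allFin) renaming (map to mapₗ)
open import Data.List.Properties using (length-++; length-take; ++-assoc)
open import Data.List.Relation.Unary.All using (All; []; _∷_; lookup) renaming (all? to allₗ?)
open import Data.List.Relation.Unary.All.Properties using (++⁺)
open import Data.List.Membership.Propositional.Properties using (∈-allFin)
open import Data.List.Extrema.Nat using (argmin; f[argmin]≤f[xs])
open import Data.Bool using (Bool; true; false; _∧_; _∨_)
open import Data.Bool.Properties using (∨-zeroʳ)
open import Data.Unit using (⊤; tt)
open import Data.Empty using (⊥-elim)
open import Data.Product using (∃; _,_; _×_)
open import Data.Sum using (_⊎_; inj₁; inj₂)
open import Function using (_∘_)
open import Relation.Binary.PropositionalEquality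
open import Relation.Nullary using (Dec; yes; no; does; ¬_; ¬?; contradiction)
open import Relation.Nullary.Decidable using (map′; _×-dec_; _⊎-dec_; from-yes; True; toWitness; dec-true)
open import Algebra.Properties.CommutativeSemigroup +-commutativeSemigroup using (xy∙z≈xz∙y; x∙yz≈xz∙y)
open ≡-Reasoning

-- sep t = 4 ∸ (least number of steps ±1, ±3 adding up to t).
sep : ℕ → ℕ
sep 1 = 3
sep 2 = 2
sep 3 = 3
sep 4 = 2
sep 5 = 1
sep 6 = 2
sep 7 = 1
sep 9 = 1
sep _ = 0

sep-far : ∀ {t} → 10 ≤ t → sep t ≡ 0
sep-far (s≤s (s≤s (s≤s (s≤s (s≤s (s≤s (s≤s (s≤s (s≤s (s≤s _)))))))))) = refl

sep>0⇒<10 : ∀ {t} → 0 < sep t → t < 10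
sep>0⇒<10 {t} pos with t <? 10
... | yes t<10 = t<10
... | no t≮10  = ⊥-elim (<-irrefl (sym (sep-far (≮⇒≥ t≮10))) pos)

sep≤3 : ∀ t → sep t ≤ 3
sep≤3 t with t <? 10
... | yes t<10 = from-yes (allUpTo? (λ t → sep t ≤? 3) 10) t<10
... | no t≮10  = subst (_≤ 3) (sym (sep-far (≮⇒≥ t≮10))) z≤n

∣-∣-split : ∀ a b → b ≡ a + ∣ a - b ∣ ⊎ a ≡ b + ∣ a - b ∣
∣-∣-split zero    b       = inj₁ refl
∣-∣-split (suc a) zero    = inj₂ refl
∣-∣-split (suc a) (suc b) with ∣-∣-split a b
... | inj₁ e = inj₁ (cong suc e)
... | inj₂ e = inj₂ (cong suc e)

module _ {n : ℕ} .{{_ : NonZero n}} where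

  +-congʳ-% : ∀ {a b} c → a % n ≡ b % n → (a + c) % n ≡ (b + c) % n
  +-congʳ-% {a} {b} c eq = begin
    (a + c) % n          ≡⟨ %-distribˡ-+ a c n ⟩
    (a % n + c % n) % n  ≡⟨ cong (λ z → (z + c % n) % n) eq ⟩
    (b % n + c % n) % n  ≡⟨ %-distribˡ-+ b c n ⟨
    (b + c) % n          ∎

  +-cancelʳ-% : ∀ {a b} c → (a + c) % n ≡ (b + c) % n → a % n ≡ b % n
  +-cancelʳ-% {a} {b} c eq = begin
    a % n                      ≡⟨ undo a ⟨
    (a + c + (n ∸ c % n)) % n  ≡⟨ +-congʳ-% (n ∸ c % n) eq ⟩
    (b + c + (n ∸ c % n)) % n  ≡⟨ undo b ⟩
    b % n                      ∎
    where
    complement : c + (n ∸ c % n) ≡ suc (c / n) * n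
    complement = begin
      c + (n ∸ c % n)                    ≡⟨ cong (_+ (n ∸ c % n)) (trans (m≡m%n+[m/n]*n c n) (+-comm (c % n) _)) ⟩
      c / n * n + c % n + (n ∸ c % n)    ≡⟨ +-assoc (c / n * n) _ _ ⟩
      c / n * n + (c % n + (n ∸ c % n))  ≡⟨ cong (c / n * n +_) (m+[n∸m]≡n (m%n≤n c n)) ⟩
      c / n * n + n                      ≡⟨ +-comm (c / n * n) n ⟩
      suc (c / n) * n                    ∎
    undo : ∀ x → (x + c + (n ∸ c % n)) % n ≡ x % n
    undo x = begin
      (x + c + (n ∸ c % n)) % n  ≡⟨ cong (_% n) (trans (+-assoc x c _) (cong (x +_) complement)) ⟩
      (x + suc (c / n) * n) % n  ≡⟨ [m+kn]%n≡m%n x (suc (c / n)) n ⟩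
      x % n                      ∎

  toℕ-%-injective : ∀ {x y : Fin n} → toℕ x % n ≡ toℕ y % n → x ≡ y
  toℕ-%-injective {x} {y} eq =
    toℕ-injective (trans (sym (m<n⇒m%n≡m (toℕ<n x))) (trans eq (m<n⇒m%n≡m (toℕ<n y))))

data Stride : Set where
  one three : Stride

size : Stride → ℕ
size one   = 1
size three = 3

data Step : Set where
  fwd bwd : Stride → Step

ahead behind : Step → ℕ
ahead  (fwd s) = size s
ahead  (bwd s) = 0
behind (fwd s) = 0
behind (bwd s) = size s

ahead* behind* : ∀ {k} → Vec Step k → ℕ
ahead*  = sum ∘ map ahead
behind* = sum ∘ map behind

all-steps? : ∀ k {P : Vec Step k → Set} → (∀ ss → Dec (P ss)) → Dec (∀ ss → P ss)
all-steps? zero    P? = map′ (λ p → λ { [] → p }) (λ f → f []) (P? [])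
all-steps? (suc k) P? = map′ (λ f → λ { (s ∷ ss) → f s ss }) (λ f s ss → f (s ∷ ss))
                             (all-step? λ s → all-steps? k λ ss → P? (s ∷ ss))
  where
  all-step? : {Q : Step → Set} → (∀ s → Dec (Q s)) → Dec (∀ s → Q s)
  all-step? Q? = map′
    (λ { (p , q , r , t) → λ { (fwd one) → p ; (fwd three) → q ; (bwd one) → r ; (bwd three) → t } })
    (λ f → f (fwd one) , f (fwd three) , f (bwd one) , f (bwd three))
    (Q? (fwd one) ×-dec Q? (fwd three) ×-dec Q? (bwd one) ×-dec Q? (bwd three))

steps-sep : ∀ {k} → k < 4 → (ss : Vec Step k) →
  ahead* ss ≡ behind* ss ⊎ 3 < sep ∣ ahead* ss - behind* ss ∣ + k
steps-sep = from-yes (allUpTo? (λ k → all-steps? k λ ss →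
  (ahead* ss ≟ behind* ss) ⊎-dec (3 <? sep ∣ ahead* ss - behind* ss ∣ + k)) 4)

module _ {n : ℕ} .{{_ : NonZero n}} (3≤n : 3 ≤ n) where

  size≤n : ∀ s → size s ≤ n
  size≤n one   = ≤-trans (s≤s z≤n) 3≤n
  size≤n three = 3≤n

  s13-stride : ∀ {d} → S13 n d → ∃ λ s → d ≡ size s ⊎ d ≡ n ∸ size s
  s13-stride (inj₁ d≡1)              = one   , inj₁ d≡1
  s13-stride (inj₂ (inj₁ d≡3))       = three , inj₁ d≡3
  s13-stride (inj₂ (inj₂ (inj₁ d≡))) = three , inj₂ d≡
  s13-stride (inj₂ (inj₂ (inj₂ d≡))) = one   , inj₂ d≡

  wrap : ∀ {a b} s → a ≡ b + (n ∸ size s) → (a + size s) % n ≡ (b + 0) % n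
  wrap {b = b} s refl = begin
    (b + (n ∸ size s) + size s) % n  ≡⟨ cong (_% n) (+-assoc b _ (size s)) ⟩
    (b + (n ∸ size s + size s)) % n  ≡⟨ cong (λ z → (b + z) % n) (m∸n+n≡m (size≤n s)) ⟩
    (b + n) % n                      ≡⟨ [m+n]%n≡m%n b n ⟩
    b % n                            ≡⟨ cong (_% n) (+-identityʳ b) ⟨
    (b + 0) % n                      ∎

  edge⇒step : ∀ {x y} → Circulant n (S13 n) x y →
    ∃ λ st → (toℕ x + ahead st) % n ≡ (toℕ y + behind st) % n
  edge⇒step {x} {y} e with s13-stride e | ∣-∣-split (toℕ x) (toℕ y)
  ... | s , inj₁ d≡s  | inj₁ y≡ = fwd s , cong (_% n) (trans (cong (toℕ x +_) (sym d≡s)) (trans (sym y≡) (sym (+-identityʳ _))))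
  ... | s , inj₁ d≡s  | inj₂ x≡ = bwd s , cong (_% n) (trans (+-identityʳ _) (trans x≡ (cong (toℕ y +_) d≡s)))
  ... | s , inj₂ d≡ns | inj₁ y≡ = bwd s , sym (wrap s (trans y≡ (cong (toℕ x +_) d≡ns)))
  ... | s , inj₂ d≡ns | inj₂ x≡ = fwd s , wrap s (trans x≡ (cong (toℕ y +_) d≡ns))

  walk⇒steps : ∀ {x y k} → Walk (Circulant n (S13 n)) x y k →
    ∃ λ (ss : Vec Step k) → (toℕ x + ahead* ss) % n ≡ (toℕ y + behind* ss) % n
  walk⇒steps nil = [] , refl
  walk⇒steps {x} {y} (cons {y = z} e w) with edge⇒step e | walk⇒steps w
  ... | st , ex | ss , ez = st ∷ ss , (begin
    (toℕ x + (a + A)) % n  ≡⟨ cong (_% n) (+-assoc (toℕ x) a A) ⟨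
    (toℕ x + a + A) % n    ≡⟨ +-congʳ-% A ex ⟩
    (toℕ z + b + A) % n    ≡⟨ cong (_% n) (xy∙z≈xz∙y (toℕ z) b A) ⟩
    (toℕ z + A + b) % n    ≡⟨ +-congʳ-% b ez ⟩
    (toℕ y + B + b) % n    ≡⟨ cong (_% n) (x∙yz≈xz∙y (toℕ y) b B) ⟨
    (toℕ y + (b + B)) % n  ∎)
    where
    a b A B : ℕ
    a = ahead st
    b = behind st
    A = ahead* ss
    B = behind* ss

CyclicSep : (n : ℕ) .{{_ : NonZero n}} → (ℕ → ℕ) → Set
CyclicSep n w = ∀ {i} → i < n → ∀ {t} → t < 10 → sep t ≤ ∣ w i - w ((i + t) % n) ∣

cyclicSep? : ∀ {n} .{{_ : NonZero n}} w → Dec (CyclicSep n w)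
cyclicSep? {n} w = allUpTo? (λ i → allUpTo? (λ t → sep t ≤? ∣ w i - w ((i + t) % n) ∣) 10) n

module _ {n : ℕ} .{{_ : NonZero n}} (3≤n : 3 ≤ n) (w : ℕ → ℕ) (sepW : CyclicSep n w) where

  private
    sep-at : ∀ x y {t d} → d < 4 → (toℕ x + t) % n ≡ toℕ y % n → 3 < sep t + d →
      sep t ≤ ∣ w (toℕ x) - w (toℕ y) ∣
    sep-at x y {t} d<4 eq big = subst (λ z → sep t ≤ ∣ w (toℕ x) - w z ∣) (trans eq (m<n⇒m%n≡m (toℕ<n y)))
      (sepW (toℕ<n x) (sep>0⇒<10 (+-cancelʳ-< 3 0 (sep t) (≤-trans big (+-monoʳ-≤ (sep t) (≤-pred d<4))))))

    shift : ∀ a b A t → (a + (A + t)) % n ≡ (b + A) % n → (a + t) % n ≡ b % n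
    shift a b A t eq = +-cancelʳ-% A (trans (cong (_% n) (sym (x∙yz≈xz∙y a A t))) eq)

  cyclicSep⇒isL321 : IsL321 (Circulant n (S13 n)) (w ∘ toℕ)
  cyclicSep⇒isL321 x y x≢y d (walk , _) with d <? 4
  ... | no d≮4 = ≤-trans (≮⇒≥ d≮4) (m≤n+m d _)
  ... | yes d<4 with walk⇒steps 3≤n walk
  ... | ss , eq with steps-sep d<4 ss | ∣-∣-split (ahead* ss) (behind* ss)
  ... | inj₁ A≡B | _ = ⊥-elim (x≢y (toℕ-%-injective
          (+-cancelʳ-% (behind* ss) (trans (cong (λ z → (toℕ x + z) % n) (sym A≡B)) eq))))
  ... | inj₂ big | inj₁ B≡ = ≤-trans big (+-monoˡ-≤ d (subst (_ ≤_) (∣-∣-comm (w (toℕ y)) (w (toℕ x)))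
          (sep-at y x d<4 (shift (toℕ y) (toℕ x) (ahead* ss) ∣ ahead* ss - behind* ss ∣
            (sym (trans eq (cong (λ z → (toℕ y + z) % n) B≡)))) big)))
  ... | inj₂ big | inj₂ A≡ = ≤-trans big (+-monoˡ-≤ d
          (sep-at x y d<4 (shift (toℕ x) (toℕ y) (behind* ss) ∣ ahead* ss - behind* ss ∣
            (trans (cong (λ z → (toℕ x + z) % n) (sym A≡)) eq)) big))

infixl 9 _!_
_!_ : List ℕ → ℕ → ℕ
[]       ! _     = 0
(x ∷ xs) ! zero  = x
(x ∷ xs) ! suc i = xs ! i

!-bounded : ∀ {K W} → All (_≤ K) W → ∀ i → W ! i ≤ K
!-bounded []       i       = z≤n
!-bounded (p ∷ ps) zero    = p
!-bounded (p ∷ ps) (suc i) = !-bounded ps i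

word⇒λ321≤ : ∀ {n K} .{{_ : NonZero n}} → 3 ≤ n → (W : List ℕ) → CyclicSep n (W !_) → All (_≤ K) W →
  λ321≤ (Circulant n (S13 n)) K
word⇒λ321≤ 3≤n W sepW bounded =
  (W !_) ∘ toℕ , cyclicSep⇒isL321 3≤n (W !_) sepW ,
  λ x y → ≤-trans (m∸n≤m (W ! toℕ x) (W ! toℕ y)) (!-bounded bounded (toℕ x))

λ321≤-word : ∀ {n} .{{_ : NonZero n}} K W →
  {True (3 ≤? n)} → {True (cyclicSep? (W !_))} → {True (allₗ? (_≤? K) W)} → λ321≤ (Circulant n (S13 n)) K
λ321≤-word K W {3≤n} {sepW} {bounded} = word⇒λ321≤ (toWitness 3≤n) W (toWitness sepW) (toWitness bounded)

Spaced : (ℕ → ℕ) → ℕ → ℕ → List ℕ → Set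
Spaced need x t []       = ⊤
Spaced need x t (y ∷ ys) = need t ≤ ∣ x - y ∣ × Spaced need x (suc t) ys

spaced? : ∀ need x t ys → Dec (Spaced need x t ys)
spaced? need x t []       = yes tt
spaced? need x t (y ∷ ys) = need t ≤? ∣ x - y ∣ ×-dec spaced? need x (suc t) ys

Separated : List ℕ → Set
Separated []       = ⊤
Separated (x ∷ xs) = Spaced sep x 1 xs × Separated xs

separated? : ∀ xs → Dec (Separated xs)
separated? []       = yes tt
separated? (x ∷ xs) = spaced? sep x 1 xs ×-dec separated? xs

spaced-far : ∀ {x t} → 10 ≤ t → ∀ ys → Spaced sep x t ys
spaced-far 10≤t []       = tt
spaced-far 10≤t (y ∷ ys) = subst (_≤ _) (sym (sep-far 10≤t)) z≤n , spaced-far (m≤n⇒m≤1+n 10≤t) ys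

spaced-take : ∀ {x t} k ys → 10 ≤ t + k → Spaced sep x t (take k ys) → Spaced sep x t ys
spaced-take {t = t} zero    ys       10≤ _        = spaced-far (subst (10 ≤_) (+-identityʳ t) 10≤) ys
spaced-take         (suc k) []       _   _        = tt
spaced-take {t = t} (suc k) (y ∷ ys) 10≤ (p , sp) = p , spaced-take k ys (subst (10 ≤_) (+-suc t k) 10≤) sp

spaced-++ : ∀ {x t} A L → 1 ≤ t → Spaced sep x t (A ++ take 9 L) → Spaced sep x t (A ++ L)
spaced-++ []      L 1≤t sp       = spaced-take 9 L (+-monoˡ-≤ 9 1≤t) sp
spaced-++ (a ∷ A) L 1≤t (p , sp) = p , spaced-++ A L (m≤n⇒m≤1+n 1≤t) sp

-- Separation only involves windows of ten consecutive labels.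
separated-++ : ∀ A L → Separated (A ++ take 9 L) → Separated L → Separated (A ++ L)
separated-++ []      L _         sL = sL
separated-++ (a ∷ A) L (sp , sA) sL = spaced-++ A L (s≤s z≤n) sp , separated-++ A L sA sL

spaced⇒sep : ∀ {x t ys j} → Spaced sep x t ys → j < length ys → sep (t + j) ≤ ∣ x - ys ! j ∣
spaced⇒sep {x} {t} {y ∷ _}  {zero}  (p , _)  _        = subst (λ s → sep s ≤ ∣ x - y ∣) (sym (+-identityʳ t)) p
spaced⇒sep {x} {t} {_ ∷ ys} {suc j} (_ , sp) (s≤s j<) =
  subst (λ s → sep s ≤ ∣ x - ys ! j ∣) (sym (+-suc t j)) (spaced⇒sep sp j<)

separated⇒sep : ∀ {xs} → Separated xs → ∀ {i t} → i + t < length xs → sep t ≤ ∣ xs ! i - xs ! (i + t) ∣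
separated⇒sep {_ ∷ _} _         {zero}  {zero}  _        = z≤n
separated⇒sep {_ ∷ _} (sp , _)  {zero}  {suc t} (s≤s t<) = spaced⇒sep sp t<
separated⇒sep {_ ∷ _} (_ , sxs) {suc i}         (s≤s i<) = separated⇒sep sxs i<

!-++ˡ : ∀ A {B i} → i < length A → (A ++ B) ! i ≡ A ! i
!-++ˡ (a ∷ A) {i = zero}  _        = refl
!-++ˡ (a ∷ A) {i = suc i} (s≤s i<) = !-++ˡ A i<

!-++ʳ : ∀ A {B} j → (A ++ B) ! (length A + j) ≡ B ! j
!-++ʳ []      j = refl
!-++ʳ (a ∷ A) j = !-++ʳ A j

!-take : ∀ k W {j} → j < k → take k W ! j ≡ W ! j
!-take (suc k) []      _                 = refl
!-take (suc k) (w ∷ W) {zero}  _        = refl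
!-take (suc k) (w ∷ W) {suc j} (s≤s j<) = !-take k W j<

-- W ++ take 9 W contains every window of ten consecutive labels of the cyclic word W.
Cyclic : List ℕ → Set
Cyclic W = Separated (W ++ take 9 W)

cyclic⇒cyclicSep : ∀ W .{{_ : NonZero (length W)}} → 9 ≤ length W → Cyclic W → CyclicSep (length W) (W !_)
cyclic⇒cyclicSep W 9≤n cyc {i} i<n {t} t<10 = subst₂ (λ a b → sep t ≤ ∣ a - b ∣) (!-++ˡ W i<n) wrapped
  (separated⇒sep cyc (subst (i + t <_) (sym lengthE) i+t<n+9))
  where
  n : ℕ
  n = length W
  i+t<n+9 : i + t < n + 9
  i+t<n+9 = +-mono-<-≤ i<n (≤-pred t<10)
  lengthE : length (W ++ take 9 W) ≡ n + 9
  lengthE = trans (length-++ W) (cong (n +_) (trans (length-take 9 W) (m≤n⇒m⊓n≡m 9≤n)))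
  wrapped : (W ++ take 9 W) ! (i + t) ≡ W ! ((i + t) % n)
  wrapped with i + t <? n
  ... | yes inside = trans (!-++ˡ W inside) (cong (W !_) (sym (m<n⇒m%n≡m inside)))
  ... | no outside = begin
    (W ++ take 9 W) ! (i + t)  ≡⟨ cong ((W ++ take 9 W) !_) n+j≡i+t ⟨
    (W ++ take 9 W) ! (n + j)  ≡⟨ !-++ʳ W j ⟩
    take 9 W ! j               ≡⟨ !-take 9 W j<9 ⟩
    W ! j                      ≡⟨ cong (W !_) (trans (sym (m<n⇒m%n≡m (<-≤-trans j<9 9≤n))) (sym ([m+n]%n≡m%n j n))) ⟩
    W ! ((j + n) % n)          ≡⟨ cong (λ z → W ! (z % n)) (trans (+-comm j n) n+j≡i+t) ⟩
    W ! ((i + t) % n)          ∎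
    where
    j : ℕ
    j = i + t ∸ n
    n+j≡i+t : n + j ≡ i + t
    n+j≡i+t = m+[n∸m]≡n (≮⇒≥ outside)
    j<9 : j < 9
    j<9 = subst (j <_) (m+n∸m≡n n 9) (∸-monoˡ-< i+t<n+9 (≮⇒≥ outside))

prefix : List ℕ
prefix = 0 ∷ 3 ∷ 10 ∷ 7 ∷ 12 ∷ 1 ∷ 4 ∷ 9 ∷ 6 ∷ []

prefix≤13 : All (_≤ 13) prefix
prefix≤13 = from-yes (allₗ? (_≤? 13) prefix)

-- As prefix has nine letters, Cyclic (prefix ++ A) unfolds to Separated (prefix ++ A ++ prefix).
Filler : List ℕ → Set
Filler A = Cyclic (prefix ++ A) × All (_≤ 13) A

filler? : ∀ A → Dec (Filler A)
filler? A = separated? (prefix ++ A ++ prefix) ×-dec allₗ? (_≤? 13) A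

filler-++ : ∀ {A B} → Filler A → Filler B → Filler (A ++ prefix ++ B)
filler-++ {A} {B} (sA , bA) (sB , bB) =
  subst (λ X → Separated (prefix ++ X)) (sym (++-assoc A (prefix ++ B) prefix))
    (separated-++ (prefix ++ A) (prefix ++ B ++ prefix) sA sB) ,
  ++⁺ bA (++⁺ prefix≤13 bB)

filler⇒λ321≤ : ∀ {A} → Filler A → λ321≤ (Circulant (9 + length A) (S13 (9 + length A))) 13
filler⇒λ321≤ {A} (sA , bA) = word⇒λ321≤ (s≤s (s≤s (s≤s z≤n))) (prefix ++ A)
  (cyclic⇒cyclicSep (prefix ++ A) (m≤m+n 9 (length A)) sA) (++⁺ prefix≤13 bA)

filler10 filler14 filler22 filler26 : List ℕ
filler10 = 13 ∷ []
filler14 = 11 ∷ 2 ∷ 13 ∷ 8 ∷ 5 ∷ []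
filler22 = 11 ∷ 0 ∷ 13 ∷ 2 ∷ 5 ∷ 10 ∷ 7 ∷ 12 ∷ 1 ∷ 4 ∷ 9 ∷ 6 ∷ 13 ∷ []
filler26 = 11 ∷ 0 ∷ 3 ∷ 8 ∷ 13 ∷ 10 ∷ 5 ∷ 2 ∷ 7 ∷ 12 ∷ 9 ∷ 4 ∷ 1 ∷ 6 ∷ 11 ∷ 8 ∷ 13 ∷ []

filler10-ok : Filler filler10
filler10-ok = from-yes (filler? filler10)

filler14-ok : Filler filler14
filler14-ok = from-yes (filler? filler14)

filler-of-length : ∀ m → m % 2 ≡ 0 → ∃ λ A → 9 + length A ≡ 20 + m × Filler A
filler-of-length 0 _ = _ , refl , filler-++ filler10-ok filler10-ok
filler-of-length 1 ()
filler-of-length 2 _ = filler22 , refl , from-yes (filler? filler22)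
filler-of-length 3 ()
filler-of-length 4 _ = _ , refl , filler-++ filler10-ok filler14-ok
filler-of-length 5 ()
filler-of-length 6 _ = filler26 , refl , from-yes (filler? filler26)
filler-of-length 7 ()
filler-of-length 8 _ = _ , refl , filler-++ filler14-ok filler14-ok
filler-of-length 9 ()
filler-of-length (suc (suc (suc (suc (suc (suc (suc (suc (suc (suc m)))))))))) even
  with filler-of-length m even
... | A , len , fA = filler10 ++ prefix ++ A , cong (10 +_) len , filler-++ filler10-ok fA

λ321≤13 : ∀ m → m % 2 ≡ 0 → m ≢ 0 → m ≢ 8 → λ321≤ (Circulant (8 + m) (S13 (8 + m))) 13
λ321≤13 0 _ m≢0 _ = ⊥-elim (m≢0 refl)
λ321≤13 1 ()
λ321≤13 2 _ _ _ = filler⇒λ321≤ filler10-ok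
λ321≤13 3 ()
λ321≤13 4 _ _ _ = λ321≤-word 13 (0 ∷ 3 ∷ 8 ∷ 11 ∷ 6 ∷ 13 ∷ 4 ∷ 1 ∷ 10 ∷ 7 ∷ 12 ∷ 5 ∷ [])
λ321≤13 5 ()
λ321≤13 6 _ _ _ = filler⇒λ321≤ filler14-ok
λ321≤13 7 ()
λ321≤13 8 _ _ m≢8 = ⊥-elim (m≢8 refl)
λ321≤13 9 ()
λ321≤13 10 _ _ _ = λ321≤-word 13 (0 ∷ 3 ∷ 6 ∷ 13 ∷ 10 ∷ 1 ∷ 8 ∷ 5 ∷ 12 ∷ 3 ∷ 0 ∷ 7 ∷ 10 ∷ 13 ∷ 2 ∷ 5 ∷ 8 ∷ 11 ∷ [])
λ321≤13 11 ()
λ321≤13 (suc (suc (suc (suc (suc (suc (suc (suc (suc (suc (suc (suc m)))))))))))) even _ _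
  with filler-of-length m even
... | A , len , fA = subst (λ k → λ321≤ (Circulant k (S13 k)) 13) len (filler⇒λ321≤ fA)

λ321≤15-8 : λ321≤ (Circulant 8 (S13 8)) 15
λ321≤15-8 = λ321≤-word 15 (0 ∷ 9 ∷ 2 ∷ 11 ∷ 4 ∷ 13 ∷ 6 ∷ 15 ∷ [])

λ321≤15-16 : λ321≤ (Circulant 16 (S13 16)) 15
λ321≤15-16 = λ321≤-word 15 (0 ∷ 3 ∷ 6 ∷ 9 ∷ 12 ∷ 1 ∷ 4 ∷ 7 ∷ 14 ∷ 11 ∷ 2 ∷ 5 ∷ 8 ∷ 13 ∷ 10 ∷ 15 ∷ [])

module _ {P : ℕ → Set} (P? : ∀ k → Dec (P k)) where

  Least≤ : ℕ → Set
  Least≤ k = ∃ λ d → d ≤ k × P d × (∀ j → j < d → ¬ P j)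

  least : ∀ {k} → P k → Least≤ k
  least {k} = <-rec (λ k → P k → Least≤ k) step k
    where
    step : ∀ k → (∀ {j} → j < k → P j → Least≤ j) → P k → Least≤ k
    step k rec pk with anyUpTo? P? k
    ... | yes (j , j<k , pj) = let d , d≤j , pd , below = rec j<k pj in d , ≤-trans d≤j (<⇒≤ j<k) , pd , below
    ... | no none            = k , ≤-refl , pk , λ j j<k pj → none (j , j<k , pj)

module _ {n : ℕ} {G : Graph n} (G? : ∀ x y → Dec (G x y)) where

  walk? : ∀ x y k → Dec (Walk G x y k)
  walk? x y zero    = map′ (λ { refl → nil }) (λ { nil → refl }) (x ≟ᶠ y)
  walk? x y (suc k) = map′ (λ (z , e , w) → cons e w) (λ { (cons e w) → _ , e , w })
                           (any? λ z → G? x z ×-dec walk? z y k)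

  walk⇒dist : ∀ {x y k} → Walk G x y k → ∃ λ d → d ≤ k × Dist G x y d
  walk⇒dist {x} {y} = least (walk? x y)

  isL321-walk : ∀ f → IsL321 G f → ∀ {x y k} → x ≢ y → Walk G x y k → 3 < ∣ f x - f y ∣ + k
  isL321-walk f isL x≢y w = let d , d≤k , dist = walk⇒dist w in ≤-trans (isL _ _ x≢y d dist) (+-monoʳ-≤ _ d≤k)

3<m+[4∸n]⇒n≤m : ∀ {n m} → n ≤ 3 → 3 < m + (4 ∸ n) → n ≤ m
3<m+[4∸n]⇒n≤m {n} {m} n≤3 lt = +-cancelʳ-≤ 4 n m
  (subst₂ _≤_ (+-comm 4 n) (trans (+-assoc m _ n) (cong (m +_) (m∸n+n≡m (m≤n⇒m≤1+n n≤3)))) (+-monoˡ-≤ n lt))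

anyBelow : ℕ → (ℕ → Bool) → Bool
anyBelow zero    p = false
anyBelow (suc m) p = p m ∨ anyBelow m p

anyBelow-intro : ∀ {p l} m → l < m → p l ≡ true → anyBelow m p ≡ true
anyBelow-intro {p} (suc m) l<m pl with m≤n⇒m<n∨m≡n (≤-pred l<m)
... | inj₁ l<m′ = trans (cong (p m ∨_) (anyBelow-intro m l<m′ pl)) (∨-zeroʳ (p m))
... | inj₂ refl = cong (_∨ anyBelow m p) pl

module _ (need : ℕ → ℕ) (L : ℕ) where

  -- Backtracking search: ys lists the labels placed so far, latest first.
  extendable : ℕ → List ℕ → Bool
  extendable zero    ys = true
  extendable (suc r) ys = anyBelow L λ l → does (spaced? need l 1 ys) ∧ extendable r (l ∷ ys)

  module _ (h : ℕ → ℕ) {n : ℕ} (h<L : ∀ {i} → i < n → h i < L)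
           (spread : ∀ {u v} → u < v → v < n → need (v ∸ u) ≤ ∣ h v - h u ∣) where

    spaced-downFrom : ∀ {v} → v < n → ∀ m → m ≤ v → Spaced need (h v) (suc (v ∸ m)) (mapₗ h (downFrom m))
    spaced-downFrom v<n zero    _   = tt
    spaced-downFrom {v} v<n (suc m) m<v =
      subst (λ t → need t ≤ ∣ h v - h m ∣) (+-∸-assoc 1 m<v) (spread m<v v<n) ,
      subst (λ t → Spaced need (h v) (suc t) (mapₗ h (downFrom m))) (+-∸-assoc 1 m<v)
        (spaced-downFrom v<n m (<⇒≤ m<v))

    labeling⇒extendable : ∀ r v → r + v ≡ n → extendable r (mapₗ h (downFrom v)) ≡ true
    labeling⇒extendable zero    v _      = refl
    labeling⇒extendable (suc r) v r+v≡n = anyBelow-intro L (h<L v<n) (cong₂ _∧_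
      (dec-true (spaced? need (h v) 1 (mapₗ h (downFrom v)))
        (subst (λ t → Spaced need (h v) (suc t) (mapₗ h (downFrom v))) (n∸n≡0 v) (spaced-downFrom v<n v ≤-refl)))
      (labeling⇒extendable r (suc v) (trans (+-suc r v) r+v≡n)))
      where
      v<n : v < n
      v<n = subst (v <_) r+v≡n (m<n+m v (s≤s z≤n))

circulant? : ∀ {n} (x y : Fin n) → Dec (Circulant n (S13 n) x y)
circulant? {n} x y = let d = ∣ toℕ x - toℕ y ∣ in d ≟ 1 ⊎-dec d ≟ 3 ⊎-dec d ≟ n ∸ 3 ⊎-dec d ≟ n ∸ 1

sepCyc : ℕ → ℕ → ℕ
sepCyc n d = sep d ⊔ sep (n ∸ d)

sepCyc≤3 : ∀ n d → sepCyc n d ≤ 3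
sepCyc≤3 n d = ⊔-lub (sep≤3 d) (sep≤3 (n ∸ d))

module _ {n′ : ℕ} where

  private
    n : ℕ
    n = suc n′

  gap : Fin n → Fin n → ℕ
  gap x y = (toℕ y + n ∸ toℕ x) % n

  rotate : ℕ → ℕ → Fin n
  rotate r p = (p + r) mod n

  Walks : Set
  Walks = ∀ x y → sepCyc n (gap x y) ≡ 0 ⊎ x ≢ y × Walk (Circulant n (S13 n)) x y (4 ∸ sepCyc n (gap x y))

  walks? : Dec Walks
  walks? = all? λ x → all? λ y → sepCyc n (gap x y) ≟ 0 ⊎-dec
    (¬? (x ≟ᶠ y) ×-dec walk? circulant? x y (4 ∸ sepCyc n (gap x y)))

  RotationInvariant : Set
  RotationInvariant = ∀ {r} → r < n → ∀ {v} → v < n → ∀ {u} → u < v → gap (rotate r u) (rotate r v) ≡ v ∸ u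

  rotationInvariant? : Dec RotationInvariant
  rotationInvariant? = allUpTo? (λ r → allUpTo? (λ v → allUpTo? (λ u → gap (rotate r u) (rotate r v) ≟ v ∸ u) v) n) n

  isL321⇒sepCyc : Walks → ∀ f → IsL321 (Circulant n (S13 n)) f → ∀ x y → sepCyc n (gap x y) ≤ ∣ f x - f y ∣
  isL321⇒sepCyc walks f isL x y with walks x y
  ... | inj₁ none      = subst (_≤ _) (sym none) z≤n
  ... | inj₂ (x≢y , w) = 3<m+[4∸n]⇒n≤m (sepCyc≤3 n (gap x y)) (isL321-walk circulant? f isL x≢y w)

  no-λ321≤ : ∀ L → {True walks?} → {True rotationInvariant?} → extendable (sepCyc n) L n′ (0 ∷ []) ≡ false →
    ∀ j → j < L → ¬ λ321≤ (Circulant n (S13 n)) j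
  no-λ321≤ L {walks} {rotation} stuck j j<L (f , isL , span) = contradiction (trans (sym found) stuck) λ ()
    where
    x₀ : Fin n
    x₀ = argmin f zero (allFin n)
    r : ℕ
    r = toℕ x₀
    h : ℕ → ℕ
    h p = f (rotate r p) ∸ f x₀

    minimal : ∀ x → f x₀ ≤ f x
    minimal x = lookup (f[argmin]≤f[xs] {f = f} zero (allFin n)) (∈-allFin x)

    h0≡0 : h 0 ≡ 0
    h0≡0 = trans (cong (λ x → f x ∸ f x₀) (toℕ-injective (trans (toℕ-fromℕ< _) (m<n⇒m%n≡m (toℕ<n x₀)))))
                 (n∸n≡0 (f x₀))

    h<L : ∀ {p} → p < n → h p < L
    h<L {p} _ = ≤-<-trans (span (rotate r p) x₀) j<L

    spread : ∀ {u v} → u < v → v < n → sepCyc n (v ∸ u) ≤ ∣ h v - h u ∣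
    spread {u} {v} u<v v<n = subst₂ (λ d e → sepCyc n d ≤ e) (toWitness rotation (toℕ<n x₀) v<n u<v) Δ≡
      (isL321⇒sepCyc (toWitness walks) f isL (rotate r u) (rotate r v))
      where
      Δ≡ : ∣ f (rotate r u) - f (rotate r v) ∣ ≡ ∣ h v - h u ∣
      Δ≡ = trans (∣-∣-comm (f (rotate r u)) _)
             (trans (cong₂ ∣_-_∣ (sym (m+[n∸m]≡n (minimal _))) (sym (m+[n∸m]≡n (minimal _))))
                    (∣m+n-m+o∣≡∣n-o∣ (f x₀) _ _))

    found : extendable (sepCyc n) L n′ (0 ∷ []) ≡ true
    found = subst (λ z → extendable (sepCyc n) L n′ (z ∷ []) ≡ true) h0≡0
      (labeling⇒extendable (sepCyc n) L h h<L spread n′ 1 (+-comm n′ 1))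

λ321≥15-8 : ∀ j → j < 15 → ¬ λ321≤ (Circulant 8 (S13 8)) j
λ321≥15-8 = no-λ321≤ 15 refl

λ321≥15-16 : ∀ j → j < 15 → ¬ λ321≤ (Circulant 16 (S13 16)) j
λ321≥15-16 = no-λ321≤ 15 refl

mainTheorem4 : (n : ℕ) → 8 ≤ n → n % 2 ≡ 0 →
    ((n ≡ 8 ⊎ n ≡ 16) → λ321≡ (Circulant n (S13 n)) 15)
    × (n ≢ 8 → n ≢ 16 → λ321≤ (Circulant n (S13 n)) 13)
mainTheorem4 n 8≤n even with m≤n⇒∃[o]m+o≡n 8≤n
... | m , refl = exact , bounded
  where
  exact : (8 + m ≡ 8 ⊎ 8 + m ≡ 16) → λ321≡ (Circulant (8 + m) (S13 (8 + m))) 15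
  exact (inj₁ refl) = λ321≤15-8 , λ321≥15-8
  exact (inj₂ refl) = λ321≤15-16 , λ321≥15-16
  bounded : 8 + m ≢ 8 → 8 + m ≢ 16 → λ321≤ (Circulant (8 + m) (S13 (8 + m))) 13
  bounded n≢8 n≢16 = λ321≤13 m even (n≢8 ∘ cong (8 +_)) (n≢16 ∘ cong (8 +_))
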